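{- Let $n\in\mathbb{N}$, let $C_n\subseteq G_n$ and let $A\in C_n$ be an interior point of $C_n$ with respect to its row or its column (i.e. there exist $B,C\in C_n$ with either $B_x=A_x=C_x$ and $B_y<A_y<C_y$, or $B_y=A_y=C_y$ and $B_x<A_x<C_x$). If there is another point of $C_n$, different from $A$, in the slope bucket of $A$, then $A$ together with two other points of $C_n$ forms an angle of $135^\circ$.
   Context: $G_n=\{(x,y): x,y\in\{1,\dots,n\}\}$; a point is written $P=(P_x,P_y)$; a construction $C_n$ is a subset of $G_n$. A slope bucket is the set of points of $G_n$ lying on a given line of slope $-1$, i.e. a set $\{(x,y)\in G_n: x+y=c\}$. Three distinct points form an angle of $\theta$ if one of the interior angles of the triangle they span equals $\theta$. -}

module Defs where

open import Data.Nat using (ℕ; _≤_; _<_; _+_)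
open import Data.Integer as ℤ using (ℤ; +_; 0ℤ)
open import Data.Product using (Σ; _×_; _,_; proj₁; proj₂; ∃; ∃-syntax)
open import Data.Sum using (_⊎_)
open import Relation.Binary.PropositionalEquality using (_≡_; _≢_)

Point : Set
Point = ℕ × ℕ

_ˣ : Point → ℕ
P ˣ = proj₁ P

_ʸ : Point → ℕ
P ʸ = proj₂ P

InGrid : ℕ → Point → Set
InGrid n P = (1 ≤ P ˣ × P ˣ ≤ n) × (1 ≤ P ʸ × P ʸ ≤ n)

Construction : ℕ → Set₁
Construction n = Σ (Point → Set) (λ C → ∀ P → C P → InGrid n P)

InteriorRowOrColumn : (Point → Set) → Point → Set
InteriorRowOrColumn C A =
  ∃[ B ] ∃[ D ] (C B × C D ×
    ((B ˣ ≡ A ˣ × A ˣ ≡ D ˣ × B ʸ < A ʸ × A ʸ < D ʸ)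
     ⊎ (B ʸ ≡ A ʸ × A ʸ ≡ D ʸ × B ˣ < A ˣ × A ˣ < D ˣ)))

-- P and Q lie in the same slope bucket (same line of slope -1): P_x+P_y = Q_x+Q_y.
SameSlopeBucket : Point → Point → Set
SameSlopeBucket P Q = P ˣ + P ʸ ≡ Q ˣ + Q ʸ

dx : Point → Point → ℤ
dx V P = + (P ˣ) ℤ.- + (V ˣ)

dy : Point → Point → ℤ
dy V P = + (P ʸ) ℤ.- + (V ʸ)

dot : Point → Point → Point → ℤ
dot V P Q = dx V P ℤ.* dx V Q ℤ.+ dy V P ℤ.* dy V Q

norm² : Point → Point → ℤ
norm² V P = dx V P ℤ.* dx V P ℤ.+ dy V P ℤ.* dy V P

-- The angle ∠PVQ (at vertex V) equals 135°, i.e.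
-- cos ∠PVQ = dot/(|VP||VQ|) = -1/√2, which for vectors with integer
-- coordinates is exactly: dot < 0 and 2·dot² = |VP|²·|VQ|².
Angle135At : Point → Point → Point → Set
Angle135At V P Q =
  (dot V P Q ℤ.< 0ℤ) × (+ 2 ℤ.* (dot V P Q ℤ.* dot V P Q) ≡ norm² V P ℤ.* norm² V Q)

FormAngle135 : Point → Point → Point → Set
FormAngle135 P Q R =
  (P ≢ Q × Q ≢ R × P ≢ R) ×
  (Angle135At P Q R ⊎ Angle135At Q P R ⊎ Angle135At R P Q)

{-# OPTIONS --safe #-}
-- Since A and P lie on a common line of slope −1, the vector from A to P is
-- (a , −a) with a ≠ 0, and it makes an angle of 45° or 135° with every
-- horizontal or vertical vector.  The two neighbours B and D of A in its row
-- or column lie in opposite directions from A, so for exactly one of them the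
-- angle ∠PAQ is obtuse, hence 135°.
module Submission where

open import Defs
open import Data.Nat using (ℕ)
open import Data.Product using (_×_; _,_; proj₁; proj₂; ∃-syntax)
open import Relation.Binary.PropositionalEquality using (_≢_)

import Data.Nat as ℕ
import Data.Nat.Properties as ℕ
open import Data.Integer
  using (+_; +0; +[1+_]; -[1+_]; 0ℤ; -_; _+_; _-_; _*_; _⊖_; _<_; _≤_; -<+; +<+; +≤+)
open import Data.Integer.Properties
  using ( +-injective; i-j≡0⇒i≡j; neg-injective; +-inverseʳ; *-zeroʳ; +-identityˡ; +-identityʳ
        ; [+m]-[+n]≡m⊖n; +-cancelˡ-⊖; ⊖-swap; +-monoˡ-<; +-mono-≤
        ; <-irrefl; <⇒≱; module ≤-Reasoning)
open import Data.Integer.Tactic.RingSolver using (solve-∀)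
open import Data.Sum using (_⊎_; inj₁; inj₂)
open import Data.Empty using (⊥-elim)
open import Relation.Binary.PropositionalEquality
  using (_≡_; refl; sym; trans; cong; cong₂; subst; module ≡-Reasoning)

AntiDiagonal : Point → Point → Set
AntiDiagonal V P = dy V P ≡ - dx V P

AxisParallel : Point → Point → Set
AxisParallel V Q = dx V Q ≡ 0ℤ ⊎ dy V Q ≡ 0ℤ

+m-+n≡0⇒m≡n : ∀ {m n} → + m - + n ≡ 0ℤ → m ≡ n
+m-+n≡0⇒m≡n {m} {n} eq = +-injective (i-j≡0⇒i≡j (+ m) (+ n) eq)

m≡n⇒+m-+n≡0 : ∀ {m n} → m ≡ n → + m - + n ≡ 0ℤ
m≡n⇒+m-+n≡0 {m} refl = +-inverseʳ (+ m)

m<n⇒+m-+n<0 : ∀ {m n} → m ℕ.< n → + m - + n < 0ℤ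
m<n⇒+m-+n<0 {m} {n} m<n = begin-strict
  + m - + n  <⟨ +-monoˡ-< (- + n) (+<+ m<n) ⟩
  + n - + n  ≡⟨ +-inverseʳ (+ n) ⟩
  0ℤ         ∎
  where open ≤-Reasoning

m<n⇒0<+n-+m : ∀ {m n} → m ℕ.< n → 0ℤ < + n - + m
m<n⇒0<+n-+m {m} {n} m<n = begin-strict
  0ℤ         ≡⟨ +-inverseʳ (+ m) ⟨
  + m - + m  <⟨ +-monoˡ-< (- + m) (+<+ m<n) ⟩
  + n - + m  ∎
  where open ≤-Reasoning

0≤i*i : ∀ i → 0ℤ ≤ i * i
0≤i*i +0       = +≤+ ℕ.z≤n
0≤i*i +[1+ n ] = +≤+ ℕ.z≤n
0≤i*i -[1+ n ] = +≤+ ℕ.z≤n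

i≢0⇒i*j<0⊎i*k<0 : ∀ i {j k} → i ≢ 0ℤ → j < 0ℤ → 0ℤ < k → i * j < 0ℤ ⊎ i * k < 0ℤ
i≢0⇒i*j<0⊎i*k<0 +0       i≢0 _   _       = ⊥-elim (i≢0 refl)
i≢0⇒i*j<0⊎i*k<0 +[1+ _ ] _   -<+ _       = inj₁ -<+
i≢0⇒i*j<0⊎i*k<0 -[1+ _ ] _   _   (+<+ (ℕ.s≤s _)) = inj₂ -<+

square-dot-identity : ∀ a q₁ q₂ → q₁ * q₂ ≡ 0ℤ →
  + 2 * ((a * q₁ + - a * q₂) * (a * q₁ + - a * q₂)) ≡ (a * a + - a * - a) * (q₁ * q₁ + q₂ * q₂)
square-dot-identity a q₁ q₂ q₁q₂≡0 = begin
  + 2 * ((a * q₁ + - a * q₂) * (a * q₁ + - a * q₂))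
    ≡⟨ expand a q₁ q₂ ⟩
  (a * a + - a * - a) * (q₁ * q₁ + q₂ * q₂) - + 4 * (a * a) * (q₁ * q₂)
    ≡⟨ cong (λ t → (a * a + - a * - a) * (q₁ * q₁ + q₂ * q₂) - + 4 * (a * a) * t) q₁q₂≡0 ⟩
  (a * a + - a * - a) * (q₁ * q₁ + q₂ * q₂) - + 4 * (a * a) * 0ℤ
    ≡⟨ drop-zero (a * a + - a * - a) (q₁ * q₁ + q₂ * q₂) (a * a) ⟩
  (a * a + - a * - a) * (q₁ * q₁ + q₂ * q₂) ∎
  where
  open ≡-Reasoning
  expand : ∀ a q₁ q₂ → + 2 * ((a * q₁ + - a * q₂) * (a * q₁ + - a * q₂))
                     ≡ (a * a + - a * - a) * (q₁ * q₁ + q₂ * q₂) - + 4 * (a * a) * (q₁ * q₂)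
  expand = solve-∀
  drop-zero : ∀ x y z → x * y - + 4 * z * 0ℤ ≡ x * y
  drop-zero = solve-∀

sameSlopeBucket⇒antiDiagonal : ∀ {V P} → SameSlopeBucket V P → AntiDiagonal V P
sameSlopeBucket⇒antiDiagonal {vx , vy} {px , py} bucket = begin
  + py - + vy                 ≡⟨ [+m]-[+n]≡m⊖n py vy ⟩
  py ⊖ vy                     ≡⟨ +-cancelˡ-⊖ px py vy ⟨
  (px ℕ.+ py) ⊖ (px ℕ.+ vy)   ≡⟨ cong (_⊖ (px ℕ.+ vy)) (sym bucket) ⟩
  (vx ℕ.+ vy) ⊖ (px ℕ.+ vy)   ≡⟨ cong₂ _⊖_ (ℕ.+-comm vx vy) (ℕ.+-comm px vy) ⟩
  (vy ℕ.+ vx) ⊖ (vy ℕ.+ px)   ≡⟨ +-cancelˡ-⊖ vy vx px ⟩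
  vx ⊖ px                     ≡⟨ ⊖-swap vx px ⟩
  - (px ⊖ vx)                 ≡⟨ cong -_ ([+m]-[+n]≡m⊖n px vx) ⟨
  - (+ px - + vx)             ∎
  where open ≡-Reasoning

dx-self : ∀ V → dx V V ≡ 0ℤ
dx-self V = +-inverseʳ (+ V ˣ)

dy-self : ∀ V → dy V V ≡ 0ℤ
dy-self V = +-inverseʳ (+ V ʸ)

dx≡0⇒dy≡0⇒≡ : ∀ {V P} → dx V P ≡ 0ℤ → dy V P ≡ 0ℤ → P ≡ V
dx≡0⇒dy≡0⇒≡ dx≡0 dy≡0 = cong₂ _,_ (+m-+n≡0⇒m≡n dx≡0) (+m-+n≡0⇒m≡n dy≡0)

antiDiagonal⇒dx≢0×dy≢0 : ∀ {V P} → AntiDiagonal V P → P ≢ V → dx V P ≢ 0ℤ × dy V P ≢ 0ℤ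
antiDiagonal⇒dx≢0×dy≢0 {V} {P} diag P≢V =
  (λ dx≡0 → P≢V (dx≡0⇒dy≡0⇒≡ dx≡0 (trans diag (cong -_ dx≡0)))) ,
  (λ dy≡0 → P≢V (dx≡0⇒dy≡0⇒≡ (neg-injective {j = 0ℤ} (trans (sym diag) dy≡0)) dy≡0))

dot-vertical : ∀ V P Q → dx V Q ≡ 0ℤ → dot V P Q ≡ dy V P * dy V Q
dot-vertical V P Q dx≡0 rewrite dx≡0 | *-zeroʳ (dx V P) = +-identityˡ _

dot-horizontal : ∀ V P Q → dy V Q ≡ 0ℤ → dot V P Q ≡ dx V P * dx V Q
dot-horizontal V P Q dy≡0 rewrite dy≡0 | *-zeroʳ (dy V P) = +-identityʳ _

axisParallel⇒dx*dy≡0 : ∀ {V Q} → AxisParallel V Q → dx V Q * dy V Q ≡ 0ℤ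
axisParallel⇒dx*dy≡0 {V} {Q} (inj₁ dx≡0) = cong (_* dy V Q) dx≡0
axisParallel⇒dx*dy≡0 {V} {Q} (inj₂ dy≡0) = trans (cong (dx V Q *_) dy≡0) (*-zeroʳ (dx V Q))

angle135-antiDiagonal-axisParallel : ∀ {V P Q} → AntiDiagonal V P → AxisParallel V Q →
  dot V P Q < 0ℤ → Angle135At V P Q
angle135-antiDiagonal-axisParallel {V} {P} {Q} diag axis dot<0 = dot<0 , squares
  where
  squares : + 2 * (dot V P Q * dot V P Q) ≡ norm² V P * norm² V Q
  squares rewrite diag =
    square-dot-identity (dx V P) (dx V Q) (dy V Q) (axisParallel⇒dx*dy≡0 {V} {Q} axis)

dot<0⇒distinct : ∀ {V P Q} → dot V P Q < 0ℤ → V ≢ P × P ≢ Q × V ≢ Q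
dot<0⇒distinct {V} {P} {Q} dot<0 = V≢P , P≢Q , V≢Q
  where
  V≢P : V ≢ P
  V≢P refl = <-irrefl (cong₂ (λ a b → a * dx V Q + b * dy V Q) (dx-self V) (dy-self V)) dot<0
  P≢Q : P ≢ Q
  P≢Q refl = <⇒≱ dot<0 (+-mono-≤ (0≤i*i (dx V P)) (0≤i*i (dy V P)))
  V≢Q : V ≢ Q
  V≢Q refl = <-irrefl dot≡0 dot<0
    where
    dot≡0 : dot V P V ≡ 0ℤ
    dot≡0 = begin
      dot V P V          ≡⟨ dot-horizontal V P V (dy-self V) ⟩
      dx V P * dx V V    ≡⟨ cong (dx V P *_) (dx-self V) ⟩
      dx V P * 0ℤ        ≡⟨ *-zeroʳ (dx V P) ⟩
      0ℤ                 ∎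
      where open ≡-Reasoning

vertical-obtuse : ∀ V P Q → Q ˣ ≡ V ˣ → dy V P * dy V Q < 0ℤ →
  AxisParallel V Q × dot V P Q < 0ℤ
vertical-obtuse V P Q Qˣ≡Vˣ neg = inj₁ dx≡0 , subst (_< 0ℤ) (sym (dot-vertical V P Q dx≡0)) neg
  where
  dx≡0 : dx V Q ≡ 0ℤ
  dx≡0 = m≡n⇒+m-+n≡0 Qˣ≡Vˣ

horizontal-obtuse : ∀ V P Q → Q ʸ ≡ V ʸ → dx V P * dx V Q < 0ℤ →
  AxisParallel V Q × dot V P Q < 0ℤ
horizontal-obtuse V P Q Qʸ≡Vʸ neg = inj₂ dy≡0 , subst (_< 0ℤ) (sym (dot-horizontal V P Q dy≡0)) neg
  where
  dy≡0 : dy V Q ≡ 0ℤ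
  dy≡0 = m≡n⇒+m-+n≡0 Qʸ≡Vʸ

obtuse-neighbour : ∀ {C : Point → Set} {A} P →
  InteriorRowOrColumn C A → AntiDiagonal A P → P ≢ A →
  ∃[ Q ] (C Q × AxisParallel A Q × dot A P Q < 0ℤ)
obtuse-neighbour {A = A} P (B , D , CB , CD , inj₁ (Bˣ≡Aˣ , Aˣ≡Dˣ , Bʸ<Aʸ , Aʸ<Dʸ)) diag P≢A
  with i≢0⇒i*j<0⊎i*k<0 (dy A P) (proj₂ (antiDiagonal⇒dx≢0×dy≢0 diag P≢A))
         (m<n⇒+m-+n<0 Bʸ<Aʸ) (m<n⇒0<+n-+m Aʸ<Dʸ)
... | inj₁ neg = B , CB , vertical-obtuse A P B Bˣ≡Aˣ neg
... | inj₂ neg = D , CD , vertical-obtuse A P D (sym Aˣ≡Dˣ) neg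
obtuse-neighbour {A = A} P (B , D , CB , CD , inj₂ (Bʸ≡Aʸ , Aʸ≡Dʸ , Bˣ<Aˣ , Aˣ<Dˣ)) diag P≢A
  with i≢0⇒i*j<0⊎i*k<0 (dx A P) (proj₁ (antiDiagonal⇒dx≢0×dy≢0 diag P≢A))
         (m<n⇒+m-+n<0 Bˣ<Aˣ) (m<n⇒0<+n-+m Aˣ<Dˣ)
... | inj₁ neg = B , CB , horizontal-obtuse A P B Bʸ≡Aʸ neg
... | inj₂ neg = D , CD , horizontal-obtuse A P D (sym Aʸ≡Dʸ) neg

lemma6 : (n : ℕ) → (Cn : Construction n) → (A : Point) →
    proj₁ Cn A →
    InteriorRowOrColumn (proj₁ Cn) A →
    (∃[ A' ] (proj₁ Cn A' × A' ≢ A × SameSlopeBucket A A')) →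
    ∃[ P ] ∃[ Q ] (proj₁ Cn P × proj₁ Cn Q × FormAngle135 A P Q)
lemma6 _ _ A _ interior (P , CP , P≢A , bucket) =
  let diag : AntiDiagonal A P
      diag = sameSlopeBucket⇒antiDiagonal {A} {P} bucket
      (Q , CQ , axis , dot<0) = obtuse-neighbour P interior diag P≢A
  in P , Q , CP , CQ , dot<0⇒distinct {A} {P} {Q} dot<0 ,
     inj₁ (angle135-antiDiagonal-axisParallel {A} {P} {Q} diag axis dot<0)
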